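{- Let $(r_0,r_1,\ldots,r_n)$ be an almost interlacing sequence of real numbers. Then: (1) if $0\le i\le j\le n$ and $i+j\le n-2$, then $r_i\le r_j$; (2) if $0\le i\le j\le n$ and $i+j\ge n+2$, then $r_i\ge r_j$.
   Context: A sequence $(a_0,\ldots,a_n)$ is unimodal if there is $k$ with $a_0\le a_1\le\dots\le a_k\ge a_{k+1}\ge\dots\ge a_n$. It satisfies (ineqA) if $a_i\le a_{n-1-i}$ and $a_{n-i}\le a_{i+1}$ for all integers $i\ge 0$ with $2i\le n-1$ (i.e. $a_0\le a_{n-1}, a_1\le a_{n-2},\ldots$ and $a_n\le a_1, a_{n-1}\le a_2,\ldots$). A sequence is almost interlacing if it is unimodal and satisfies (ineqA). -}

module Defs where

open import Level using (Level)
open import Data.Nat using (ℕ; suc; _+_; _*_; _∸_; _<_) renaming (_≤_ to _≤ℕ_)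
open import Data.Product using (Σ; _×_)
open import Relation.Binary.Bundles using (TotalOrder)

-- A finite sequence (a_0, ..., a_n) is represented by a function a : ℕ → A
-- together with the length parameter n; only the values a 0 .. a n matter.
module _ {c ℓ₁ ℓ₂ : Level} (O : TotalOrder c ℓ₁ ℓ₂) where
  open TotalOrder O renaming (Carrier to A)

  Unimodal : ℕ → (ℕ → A) → Set _
  Unimodal n a =
    Σ ℕ λ k → k ≤ℕ n
      × (∀ i → i < k → a i ≤ a (suc i))
      × (∀ i → k ≤ℕ i → i < n → a (suc i) ≤ a i)

  IneqA : ℕ → (ℕ → A) → Set _
  IneqA n a =
    ∀ i → suc (2 * i) ≤ℕ n → (a i ≤ a (n ∸ 1 ∸ i)) × (a (n ∸ i) ≤ a (suc i))

  AlmostInterlacing : ℕ → (ℕ → A) → Set _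
  AlmostInterlacing n a = Unimodal n a × IneqA n a

{-# OPTIONS --safe #-}
module Submission where

-- Unimodality settles every comparison that stays on one side of the peak k.
-- Otherwise (ineqA) compares one term with its mirror image about the centre,
-- and unimodality carries this on to the other term: if i + j ≤ n - 2 and
-- j > k, then k < j ≤ n - 1 - i, so r_i ≤ r_{n-1-i} ≤ r_j; if i + j ≥ n + 2 and
-- i < k, then n - j + 1 ≤ i < k, so r_j ≤ r_{n-j+1} ≤ r_i.

open import Defs
open import Level using (Level)
open import Data.Nat
  using (ℕ; suc; _+_; _*_; _∸_; _<_; _≤′_; ≤′-refl; ≤′-step; z<s; s≤s; _≤?_)
  renaming (_≤_ to _≤ℕ_)
open import Data.Nat.Properties
  using ( ≤-trans; ≤-reflexive; <⇒≤; <-≤-trans; ≰⇒>; ≤⇒≤′; ≤′⇒≤; module ≤-Reasoning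
        ; +-comm; +-suc; +-identityʳ; +-monoʳ-≤; +-cancelʳ-≤; m<m+n; n≤1+n
        ; m∸n≤m; m+n∸m≡n; m+[n∸m]≡n; m∸n+n≡m; m+n≤o⇒m≤o∸n; m+n≤o⇒n≤o )
open import Data.Product using (_×_; _,_; proj₁; proj₂)
open import Relation.Nullary using (yes; no)
open import Relation.Binary.PropositionalEquality using (_≡_; refl; sym; subst; cong)
open import Relation.Binary.Bundles using (Preorder; TotalOrder)

module StepwiseMonotone {c ℓ₁ ℓ₂ : Level} (P : Preorder c ℓ₁ ℓ₂)
  {a : ℕ → Preorder.Carrier P} where
  open Preorder P using (_≲_) renaming (refl to ≲-refl; trans to ≲-trans)

  increasing-below : ∀ {k} → (∀ i → i < k → a i ≲ a (suc i)) →
                     ∀ {i j} → i ≤ℕ j → j ≤ℕ k → a i ≲ a j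
  increasing-below {k} up i≤j = go (≤⇒≤′ i≤j)
    where
    go : ∀ {i j} → i ≤′ j → j ≤ℕ k → a i ≲ a j
    go ≤′-refl _ = ≲-refl
    go (≤′-step i≤′j) j<k = ≲-trans (go i≤′j (<⇒≤ j<k)) (up _ j<k)

  decreasing-between : ∀ {k n} → (∀ i → k ≤ℕ i → i < n → a (suc i) ≲ a i) →
                       ∀ {i j} → k ≤ℕ i → i ≤ℕ j → j ≤ℕ n → a j ≲ a i
  decreasing-between {k} {n} down {i} k≤i i≤j = go (≤⇒≤′ i≤j)
    where
    go : ∀ {j} → i ≤′ j → j ≤ℕ n → a j ≲ a i
    go ≤′-refl _ = ≲-refl
    go (≤′-step i≤′j) j<n =
      ≲-trans (down _ (≤-trans k≤i (≤′⇒≤ i≤′j)) j<n) (go i≤′j (<⇒≤ j<n))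

module _ {c ℓ₁ ℓ₂ : Level} (O : TotalOrder c ℓ₁ ℓ₂) {n : ℕ}
  {a : ℕ → TotalOrder.Carrier O} where
  open TotalOrder O using (_≤_; trans; preorder)
  open StepwiseMonotone preorder

  private
    2*i<1+i+m : ∀ {i m} → i ≤ℕ m → suc (2 * i) ≤ℕ suc (i + m)
    2*i<1+i+m {i} i≤m = s≤s (+-monoʳ-≤ i (≤-trans (≤-reflexive (+-identityʳ i)) i≤m))

  IneqA⇒≤-mirror : IneqA O n a → ∀ {i m} → i ≤ℕ m → suc (i + m) ≡ n → a i ≤ a m
  IneqA⇒≤-mirror ineqA {i} {m} i≤m refl =
    subst (λ l → a i ≤ a l) (m+n∸m≡n i m) (proj₁ (ineqA i (2*i<1+i+m i≤m)))

  IneqA⇒≥-mirror : IneqA O n a → ∀ {i j} → i < j → i + j ≡ n → a j ≤ a (suc i)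
  IneqA⇒≥-mirror ineqA {i} {suc m} (s≤s i≤m) refl =
    subst (λ l → a l ≤ a (suc i)) (m+n∸m≡n i (suc m))
      (proj₂ (ineqA i (≤-trans (2*i<1+i+m i≤m) (≤-reflexive (sym (+-suc i m))))))

  almostInterlacing-increasing-left : AlmostInterlacing O n a →
    ∀ {i j} → i ≤ℕ j → i + j + 2 ≤ℕ n → a i ≤ a j
  almostInterlacing-increasing-left ((k , _ , up , down) , ineqA) {i} {j} i≤j i+j+2≤n
    with j ≤? k
  ... | yes j≤k = increasing-below up i≤j j≤k
  ... | no  j≰k =
    trans (IneqA⇒≤-mirror ineqA (≤-trans i≤j j≤m) (m+[n∸m]≡n (m+n≤o⇒n≤o j j+1+i≤n)))
          (decreasing-between down (<⇒≤ (≰⇒> j≰k)) j≤m (m∸n≤m n (suc i)))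
    where
    open ≤-Reasoning
    j+1+i≤n : j + suc i ≤ℕ n
    j+1+i≤n = begin
      j + suc i    ≡⟨ +-comm j (suc i) ⟩
      suc (i + j)  ≤⟨ n≤1+n _ ⟩
      2 + (i + j)  ≡⟨ +-comm 2 (i + j) ⟩
      i + j + 2    ≤⟨ i+j+2≤n ⟩
      n            ∎
    j≤m : j ≤ℕ n ∸ suc i
    j≤m = m+n≤o⇒m≤o∸n j j+1+i≤n

  almostInterlacing-decreasing-right : AlmostInterlacing O n a →
    ∀ {i j} → i ≤ℕ j → j ≤ℕ n → n + 2 ≤ℕ i + j → a j ≤ a i
  almostInterlacing-decreasing-right ((k , _ , up , down) , ineqA) {i} {j} i≤j j≤n n+2≤i+j
    with k ≤? i
  ... | yes k≤i = decreasing-between down k≤i i≤j j≤n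
  ... | no  k≰i =
    trans (IneqA⇒≥-mirror ineqA (<-≤-trans n∸j<i i≤j) (m∸n+n≡m j≤n))
          (increasing-below up n∸j<i (<⇒≤ (≰⇒> k≰i)))
    where
    open ≤-Reasoning
    n∸j<i : n ∸ j < i
    n∸j<i = +-cancelʳ-≤ j (suc (n ∸ j)) i (begin
      suc (n ∸ j + j)  ≡⟨ cong suc (m∸n+n≡m j≤n) ⟩
      suc n            ≤⟨ m<m+n n z<s ⟩
      n + 2            ≤⟨ n+2≤i+j ⟩
      i + j            ∎)

mainTheorem1 : {c ℓ₁ ℓ₂ : Level} (O : TotalOrder c ℓ₁ ℓ₂) (n : ℕ)
    (r : ℕ → TotalOrder.Carrier O) →
    AlmostInterlacing O n r →
    (∀ i j → i ≤ℕ j → j ≤ℕ n → i + j + 2 ≤ℕ n → TotalOrder._≤_ O (r i) (r j))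
    × (∀ i j → i ≤ℕ j → j ≤ℕ n → n + 2 ≤ℕ i + j → TotalOrder._≤_ O (r j) (r i))
mainTheorem1 O n r almostInterlacing =
    (λ _ _ i≤j _ i+j+2≤n → almostInterlacing-increasing-left O almostInterlacing i≤j i+j+2≤n)
  , (λ _ _ → almostInterlacing-decreasing-right O almostInterlacing)
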